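{- For any integer $n>1$, the multiplicity of $n$ as a Laplacian eigenvalue of the power graph $\mathcal{G}(\mathbb{Z}_n)$ is $\phi(n)+1$ if and only if $n=4$ or $n$ is not a prime power.
   Context: $\mathbb{Z}_n$ is the additive cyclic group of order $n$; $\phi$ is Euler's phi function. The power graph $\mathcal{G}(G)$ of a group $G$ has vertex set $G$, distinct $u,v$ adjacent iff one is a positive power of the other. Laplacian eigenvalues are the eigenvalues of $L(\Gamma)=D(\Gamma)-A(\Gamma)$ (degree matrix minus adjacency matrix). A prime power means $p^\alpha$ with $p$ prime and $\alpha\in\mathbb{N}$. -}

module Defs where

open import Data.Nat using (ℕ; zero; suc; _+_; _*_; _^_; _≤_; _<_)
open import Data.Nat.GCD using (gcd)
open import Data.Nat.Primality using (Prime)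
open import Data.Fin using (Fin; toℕ)
open import Data.Bool using (Bool; true; false; if_then_else_)
open import Data.List using (List; length; filter; upTo; map)
open import Data.Product using (Σ; ∃; ∃-syntax; _×_)
open import Data.Sum using (_⊎_)
open import Relation.Binary.PropositionalEquality using (_≡_; _≢_)
open import Relation.Nullary using (¬_)
import Data.Nat as ℕ
open import Data.Rational as ℚ using (ℚ; 0ℚ; 1ℚ)

φ : ℕ → ℕ
φ n = length (filter (λ k → gcd k n ℕ.≟ 1) (map suc (upTo n)))

IsPrimePower : ℕ → Set
IsPrimePower n = ∃[ p ] ∃[ α ] (Prime p × 1 ≤ α × n ≡ p ^ α)

-- The power graph of ℤ_n.  Elements of ℤ_n are represented by Fin n
-- (residues 0,…,n-1); the k-th (additive) power of v is k·v mod n.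

-- u is a positive power of v in ℤ_n: u = k·v (mod n) for some k ≥ 1,
-- i.e. k·v = u + q·n for some q (u < n, so this is k·v mod n = u).
IsPowerOf : (n : ℕ) → Fin n → Fin n → Set
IsPowerOf n u v = ∃[ k ] ∃[ q ] (1 ≤ k × k * toℕ v ≡ toℕ u + q * n)

IsPowerGraphAdj : (n : ℕ) → (Fin n → Fin n → Bool) → Set
IsPowerGraphAdj n adj =
  (u v : Fin n) →
    (adj u v ≡ true → (u ≢ v × (IsPowerOf n u v ⊎ IsPowerOf n v u))) ×
    ((u ≢ v × (IsPowerOf n u v ⊎ IsPowerOf n v u)) → adj u v ≡ true)

sumFin : (n : ℕ) → (Fin n → ℚ) → ℚ
sumFin zero    f = 0ℚ
sumFin (suc n) f = f Fin.zero ℚ.+ sumFin n (λ i → f (Fin.suc i))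
  where import Data.Fin as Fin

Matrix : ℕ → Set
Matrix n = Fin n → Fin n → ℚ

Vector : ℕ → Set
Vector n = Fin n → ℚ

boolℚ : Bool → ℚ
boolℚ b = if b then 1ℚ else 0ℚ

adjMatrix : (n : ℕ) → (Fin n → Fin n → Bool) → Matrix n
adjMatrix n adj u v = boolℚ (adj u v)

degree : (n : ℕ) → (Fin n → Fin n → Bool) → Fin n → ℚ
degree n adj u = sumFin n (adjMatrix n adj u)

degMatrix : (n : ℕ) → (Fin n → Fin n → Bool) → Matrix n
degMatrix n adj u v = if ⌊ u Data.Fin.≟ v ⌋ then degree n adj u else 0ℚ
  where open import Relation.Nullary.Decidable using (⌊_⌋)
        import Data.Fin

laplacian : (n : ℕ) → (Fin n → Fin n → Bool) → Matrix n
laplacian n adj u v = degMatrix n adj u v ℚ.- adjMatrix n adj u v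

InEigenspace : (n : ℕ) → Matrix n → ℚ → Vector n → Set
InEigenspace n M λ′ x = (u : Fin n) → sumFin n (λ v → M u v ℚ.* x v) ≡ λ′ ℚ.* x u

LinIndep : (n m : ℕ) → (Fin m → Vector n) → Set
LinIndep n m vs = (c : Fin m → ℚ) →
  ((j : Fin n) → sumFin m (λ i → c i ℚ.* vs i j) ≡ 0ℚ) → (i : Fin m) → c i ≡ 0ℚ

-- For a symmetric matrix (such as a
-- Laplacian) this geometric multiplicity equals the algebraic one.
EigenvalueMultiplicity : (n : ℕ) → Matrix n → ℚ → ℕ → Set
EigenvalueMultiplicity n M λ′ m =
  (Σ (Fin m → Vector n) λ vs → ((i : Fin m) → InEigenspace n M λ′ (vs i)) × LinIndep n m vs) ×
  ((ws : Fin (suc m) → Vector n) → ((i : Fin (suc m)) → InEigenspace n M λ′ (ws i)) → ¬ LinIndep n (suc m) ws)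

natℚ : ℕ → ℚ
natℚ n = (Data.Integer.+ n) ℚ./ 1
  where import Data.Integer

{-# OPTIONS --safe #-}
module Submission where

-- Let x be an eigenvector of the Laplacian L for the eigenvalue n (the number of vertices). The
-- column sums of L vanish, so Σ x = 0, and then the weights 1 - A give the Laplacian nI - J - L of
-- the complement, which annihilates x; its quadratic form is a sum of squares, so x is constant
-- along every non-edge. Conversely, for a vertex d adjacent to all others, n e_d - 1 is an
-- eigenvector. In G(ℤ_n) the vertex 0 and the φ(n) generators are adjacent to all others, and an
-- edge u ~ v forces gcd(u, n) and gcd(v, n) to be comparable under divisibility.
--
-- If n = ab with coprime a, b ≥ 2, every vertex other than 0 and the generators is joined to the
-- vertex a by non-edges, directly or through b, so an eigenvector vanishing on 0 and the generators
-- vanishes: the multiplicity is φ(n) + 1; for n = 4 only the vertex 2 is left and the same holds.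
-- If n = p is prime, an eigenvector vanishing on the generators vanishes, so the multiplicity is
-- only φ(p). If n = p^k ≠ 4 with k ≥ 2, the vertex p is adjacent to all others as well while 2p is
-- not, giving φ(n) + 2 independent eigenvectors.

module Sums where

  open import Defs
  open import Data.Nat as ℕ using (ℕ; zero; suc)
  open import Data.Fin using (Fin; zero; suc; punchIn)
  open import Data.Fin.Properties using (punchInᵢ≢i)
  open import Data.Vec.Functional using (insertAt)
  open import Data.Vec.Functional.Properties using (insertAt-lookup; insertAt-punchIn)
  open import Data.Rational as ℚ using (ℚ; 0ℚ; 1ℚ; _+_; _*_; -_; _-_; _≤_)
  open import Data.Rational.Properties
  open import Relation.Binary.PropositionalEquality
  import Data.Nat.Coprimality as Coprime
  import Data.Integer as ℤ
  import Data.Integer.Properties as ℤ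
  open import Algebra.Bundles using (CommutativeRing)
  open import Algebra.Properties.Semiring.Sum (CommutativeRing.semiring +-*-commutativeRing)
    using (sum; sum-cong-≗; sum-replicate-zero; ∑-distrib-+; ∑-comm; sum-remove; *-distribˡ-sum; *-distribʳ-sum)
  open import Algebra.Properties.Ring (CommutativeRing.ring +-*-commutativeRing) using (-1*x≈-x)
  open ≡-Reasoning

  natℚ≡mkℚ : ∀ n → natℚ n ≡ ℚ.mkℚ (ℤ.+ n) 0 (Coprime.sym (Coprime.1-coprimeTo n))
  natℚ≡mkℚ n = normalize-coprime (Coprime.sym (Coprime.1-coprimeTo n))

  natℚ-suc : ∀ n → natℚ (suc n) ≡ 1ℚ + natℚ n
  natℚ-suc n = trans (/-cong (cong (ℤ._+_ ℤ.1ℤ) (sym (ℤ.*-identityʳ (ℤ.+ n)))) refl)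
                      (cong (1ℚ +_) (sym (natℚ≡mkℚ n)))

  natℚ-nonZero : ∀ n → .{{ℕ.NonZero n}} → natℚ n ≢ 0ℚ
  natℚ-nonZero (suc n) eq with cong ℚ.↥_ (trans (sym (natℚ≡mkℚ (suc n))) eq)
  ... | ()

  sumFin≡sum : ∀ n (f : Fin n → ℚ) → sumFin n f ≡ sum f
  sumFin≡sum zero    f = refl
  sumFin≡sum (suc n) f = cong (f zero +_) (sumFin≡sum n (λ i → f (suc i)))

  sumFin-cong : ∀ n {f g : Fin n → ℚ} → (∀ i → f i ≡ g i) → sumFin n f ≡ sumFin n g
  sumFin-cong n {f} {g} f≗g = begin
    sumFin n f ≡⟨ sumFin≡sum n f ⟩
    sum f      ≡⟨ sum-cong-≗ f≗g ⟩
    sum g      ≡⟨ sumFin≡sum n g ⟨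
    sumFin n g ∎

  sumFin-zero : ∀ n → sumFin n (λ _ → 0ℚ) ≡ 0ℚ
  sumFin-zero n = trans (sumFin≡sum n _) (sum-replicate-zero n)

  sumFin-distrib-+ : ∀ n (f g : Fin n → ℚ) → sumFin n (λ i → f i + g i) ≡ sumFin n f + sumFin n g
  sumFin-distrib-+ n f g = begin
    sumFin n (λ i → f i + g i) ≡⟨ sumFin≡sum n _ ⟩
    sum (λ i → f i + g i)      ≡⟨ ∑-distrib-+ f g ⟩
    sum f + sum g              ≡⟨ cong₂ _+_ (sumFin≡sum n f) (sumFin≡sum n g) ⟨
    sumFin n f + sumFin n g    ∎

  *-distribˡ-sumFin : ∀ n a (f : Fin n → ℚ) → a * sumFin n f ≡ sumFin n (λ i → a * f i)
  *-distribˡ-sumFin n a f = begin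
    a * sumFin n f             ≡⟨ cong (a *_) (sumFin≡sum n f) ⟩
    a * sum f                  ≡⟨ *-distribˡ-sum a f ⟩
    sum (λ i → a * f i)        ≡⟨ sumFin≡sum n _ ⟨
    sumFin n (λ i → a * f i)   ∎

  *-distribʳ-sumFin : ∀ n a (f : Fin n → ℚ) → sumFin n f * a ≡ sumFin n (λ i → f i * a)
  *-distribʳ-sumFin n a f = begin
    sumFin n f * a             ≡⟨ cong (_* a) (sumFin≡sum n f) ⟩
    sum f * a                  ≡⟨ *-distribʳ-sum a f ⟩
    sum (λ i → f i * a)        ≡⟨ sumFin≡sum n _ ⟨
    sumFin n (λ i → f i * a)   ∎

  neg-distrib-sumFin : ∀ n (f : Fin n → ℚ) → - sumFin n f ≡ sumFin n (λ i → - f i)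
  neg-distrib-sumFin n f = begin
    - sumFin n f                   ≡⟨ -1*x≈-x (sumFin n f) ⟨
    - 1ℚ * sumFin n f              ≡⟨ *-distribˡ-sumFin n (- 1ℚ) f ⟩
    sumFin n (λ i → - 1ℚ * f i)    ≡⟨ sumFin-cong n (λ i → -1*x≈-x (f i)) ⟩
    sumFin n (λ i → - f i)         ∎

  sumFin-distrib-- : ∀ n (f g : Fin n → ℚ) → sumFin n (λ i → f i - g i) ≡ sumFin n f - sumFin n g
  sumFin-distrib-- n f g = trans (sumFin-distrib-+ n f (λ i → - g i))
                                 (cong (sumFin n f +_) (sym (neg-distrib-sumFin n g)))

  sumFin-comm : ∀ m n (f : Fin m → Fin n → ℚ) →
                sumFin m (λ i → sumFin n (f i)) ≡ sumFin n (λ j → sumFin m (λ i → f i j))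
  sumFin-comm m n f = begin
    sumFin m (λ i → sumFin n (f i))         ≡⟨ sumFin-cong m (λ i → sumFin≡sum n (f i)) ⟩
    sumFin m (λ i → sum (f i))              ≡⟨ sumFin≡sum m _ ⟩
    sum (λ i → sum (f i))                   ≡⟨ ∑-comm f ⟩
    sum (λ j → sum (λ i → f i j))           ≡⟨ sumFin≡sum n _ ⟨
    sumFin n (λ j → sum (λ i → f i j))      ≡⟨ sumFin-cong n (λ j → sumFin≡sum m (λ i → f i j)) ⟨
    sumFin n (λ j → sumFin m (λ i → f i j)) ∎

  sumFin-remove : ∀ n (f : Fin (suc n) → ℚ) i → sumFin (suc n) f ≡ f i + sumFin n (λ j → f (punchIn i j))
  sumFin-remove n f i = begin
    sumFin (suc n) f                   ≡⟨ sumFin≡sum (suc n) f ⟩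
    sum f                              ≡⟨ sum-remove f ⟩
    f i + sum (λ j → f (punchIn i j))  ≡⟨ cong (f i +_) (sumFin≡sum n _) ⟨
    f i + sumFin n (λ j → f (punchIn i j)) ∎

  sumFin-single : ∀ n (f : Fin n → ℚ) u → (∀ v → v ≢ u → f v ≡ 0ℚ) → sumFin n f ≡ f u
  sumFin-single (suc n) f u f≡0 = begin
    sumFin (suc n) f                       ≡⟨ sumFin-remove n f u ⟩
    f u + sumFin n (λ j → f (punchIn u j)) ≡⟨ cong (f u +_) (sumFin-cong n (λ j → f≡0 _ (punchInᵢ≢i u j))) ⟩
    f u + sumFin n (λ _ → 0ℚ)              ≡⟨ cong (f u +_) (sumFin-zero n) ⟩
    f u + 0ℚ                               ≡⟨ +-identityʳ (f u) ⟩
    f u                                    ∎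

  sumFin-const : ∀ n c → sumFin n (λ _ → c) ≡ natℚ n * c
  sumFin-const zero    c = sym (*-zeroˡ c)
  sumFin-const (suc n) c = begin
    c + sumFin n (λ _ → c)  ≡⟨ cong (c +_) (sumFin-const n c) ⟩
    c + natℚ n * c          ≡⟨ cong (_+ natℚ n * c) (*-identityˡ c) ⟨
    1ℚ * c + natℚ n * c     ≡⟨ *-distribʳ-+ c 1ℚ (natℚ n) ⟨
    (1ℚ + natℚ n) * c       ≡⟨ cong (_* c) (natℚ-suc n) ⟨
    natℚ (suc n) * c        ∎

  sumFin-nonneg : ∀ n (f : Fin n → ℚ) → (∀ i → 0ℚ ≤ f i) → 0ℚ ≤ sumFin n f
  sumFin-nonneg zero    f f≥0 = ≤-refl
  sumFin-nonneg (suc n) f f≥0 = +-mono-≤ (f≥0 zero) (sumFin-nonneg n (λ i → f (suc i)) (λ i → f≥0 (suc i)))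

  term≤sumFin : ∀ n (f : Fin n → ℚ) → (∀ i → 0ℚ ≤ f i) → ∀ i → f i ≤ sumFin n f
  term≤sumFin (suc n) f f≥0 i = subst₂ _≤_ (+-identityʳ (f i)) (sym (sumFin-remove n f i))
    (+-monoʳ-≤ (f i) (sumFin-nonneg n _ (λ j → f≥0 (punchIn i j))))

  sumFin-nonneg-zero : ∀ n (f : Fin n → ℚ) → (∀ i → 0ℚ ≤ f i) → sumFin n f ≡ 0ℚ → ∀ i → f i ≡ 0ℚ
  sumFin-nonneg-zero n f f≥0 Σf≡0 i = ≤-antisym (subst (f i ≤_) Σf≡0 (term≤sumFin n f f≥0 i)) (f≥0 i)

  sumFin-insertAt : ∀ m (c : Fin m → ℚ) p x (v : Fin (suc m) → ℚ) →
    sumFin (suc m) (λ i → insertAt c p x i * v i) ≡ x * v p + sumFin m (λ i → c i * v (punchIn p i))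
  sumFin-insertAt m c p x v = trans (sumFin-remove m (λ i → insertAt c p x i * v i) p)
    (cong₂ _+_ (cong (_* v p) (insertAt-lookup c p x))
               (sumFin-cong m (λ i → cong (_* v (punchIn p i)) (insertAt-punchIn c p x i))))

module LinearAlgebra where

  open import Defs
  open Sums
  open import Data.Nat using (zero; suc)
  open import Data.Fin as Fin using (Fin; zero; suc; punchIn)
  open import Data.Fin.Properties using (all?; ¬∀⟶∃¬)
  open import Data.Vec.Functional using (insertAt)
  open import Data.Vec.Functional.Properties using (insertAt-punchIn)
  open import Data.Rational as ℚ using (ℚ; 0ℚ; 1ℚ; _+_; _*_; -_; _-_; 1/_)
  open import Data.Rational.Properties
  open import Data.Rational.Solver using (module +-*-Solver)
  open import Data.Product using (Σ; ∃-syntax; ∃₂; _×_; _,_)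
  open import Data.Bool using (if_then_else_)
  open import Relation.Binary.PropositionalEquality
  open import Function using (_∘_)
  open import Relation.Nullary using (¬_; Dec; yes; no)
  open import Relation.Nullary.Decidable using (⌊_⌋; isYes≗does; dec-true; dec-false)
  open import Algebra.Properties.Group +-0-group using (x∙y⁻¹≈ε⇒x≈y)
  open +-*-Solver using (solve; _:+_; _:*_; :-_; _:-_; _:=_; con)

  *-cancelˡ-zero : ∀ p q → p ≢ 0ℚ → p * q ≡ 0ℚ → q ≡ 0ℚ
  *-cancelˡ-zero p q p≢0 pq≡0 = begin
    q              ≡⟨ *-identityˡ q ⟨
    1ℚ * q         ≡⟨ cong (_* q) (*-inverseˡ p) ⟨
    1/ p * p * q   ≡⟨ *-assoc (1/ p) p q ⟩
    1/ p * (p * q) ≡⟨ cong (1/ p *_) pq≡0 ⟩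
    1/ p * 0ℚ      ≡⟨ *-zeroʳ (1/ p) ⟩
    0ℚ             ∎
    where
    open ≡-Reasoning
    instance _ = ℚ.≢-nonZero p≢0

  if-yes : ∀ {A : Set} (a? : Dec A) {x y : ℚ} → A → (if ⌊ a? ⌋ then x else y) ≡ x
  if-yes a? a = cong (if_then _ else _) (trans (isYes≗does a?) (dec-true a? a))

  if-no : ∀ {A : Set} (a? : Dec A) {x y : ℚ} → ¬ A → (if ⌊ a? ⌋ then x else y) ≡ y
  if-no a? ¬a = cong (if_then _ else _) (trans (isYes≗does a?) (dec-false a? ¬a))

  δ : ∀ {n} → Fin n → Fin n → ℚ
  δ i j = boolℚ ⌊ i Fin.≟ j ⌋

  δ-refl : ∀ {n} (i : Fin n) → δ i i ≡ 1ℚ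
  δ-refl i = if-yes (i Fin.≟ i) refl

  δ-≢ : ∀ {n} {i j : Fin n} → i ≢ j → δ i j ≡ 0ℚ
  δ-≢ {i = i} {j} = if-no (i Fin.≟ j)

  linearCombination : ∀ {m n} → (Fin m → ℚ) → (Fin m → Vector n) → Vector n
  linearCombination {m} c vs j = sumFin m (λ i → c i * vs i j)

  Dependent : ∀ n m → (Fin m → Vector n) → Set
  Dependent n m vs = Σ (Fin m → ℚ) λ c → (∃[ i ] c i ≢ 0ℚ) × (∀ j → linearCombination c vs j ≡ 0ℚ)

  dependent⇒¬LinIndep : ∀ {n m} {vs : Fin m → Vector n} → Dependent n m vs → ¬ LinIndep n m vs
  dependent⇒¬LinIndep (c , (i , cᵢ≢0) , c·vs≡0) indep = cᵢ≢0 (indep c c·vs≡0 i)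

  pivot-row : ∀ m {n} (vs : Fin (suc m) → Vector (suc n)) →
    ∃₂ λ p (r : Fin m → ℚ) → ∀ i → vs (punchIn p i) zero ≡ r i * vs p zero
  pivot-row m vs with all? (λ i → vs i zero ≟ 0ℚ)
  ... | yes column≡0 = zero , (λ _ → 0ℚ) , λ i → trans (column≡0 (suc i)) (sym (*-zeroˡ (vs zero zero)))
  ... | no column≢0 with ¬∀⟶∃¬ (suc m) _ (λ i → vs i zero ≟ 0ℚ) column≢0
  ... | p , a≢0 = p , (λ i → vs (punchIn p i) zero * 1/ a) , λ i → sym (begin
    vs (punchIn p i) zero * 1/ a * a   ≡⟨ *-assoc (vs (punchIn p i) zero) (1/ a) a ⟩
    vs (punchIn p i) zero * (1/ a * a) ≡⟨ cong (vs (punchIn p i) zero *_) (*-inverseˡ a) ⟩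
    vs (punchIn p i) zero * 1ℚ         ≡⟨ *-identityʳ _ ⟩
    vs (punchIn p i) zero              ∎)
    where
    open ≡-Reasoning
    a : ℚ
    a = vs p zero
    instance _ = ℚ.≢-nonZero a≢0

  -- Gaussian elimination: clear the first coordinate with the pivot row, recurse on the other rows.
  more-vectors-than-coordinates⇒dependent : ∀ m (vs : Fin (suc m) → Vector m) → Dependent m (suc m) vs
  more-vectors-than-coordinates⇒dependent zero    vs = (λ _ → 1ℚ) , (zero , 1≢0) , λ ()
  more-vectors-than-coordinates⇒dependent (suc m) vs with pivot-row (suc m) vs
  ... | p , r , column₀ with more-vectors-than-coordinates⇒dependent m
                               (λ i j → vs (punchIn p i) (suc j) - r i * vs p (suc j))
  ... | c′ , (k , c′ₖ≢0) , c′·w≡0 = c , (punchIn p k , cₚₖ≢0) , c·vs≡0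
    where
    open ≡-Reasoning
    w : Fin (suc m) → Vector m
    w i j = vs (punchIn p i) (suc j) - r i * vs p (suc j)
    S : ℚ
    S = sumFin (suc m) (λ i → c′ i * r i)
    c : Fin (suc (suc m)) → ℚ
    c = insertAt c′ p (- S)

    cₚₖ≢0 : c (punchIn p k) ≢ 0ℚ
    cₚₖ≢0 = subst (_≢ 0ℚ) (sym (insertAt-punchIn c′ p (- S) k)) c′ₖ≢0

    scaled : ∀ x → sumFin (suc m) (λ i → c′ i * (r i * x)) ≡ S * x
    scaled x = trans (sumFin-cong (suc m) (λ i → sym (*-assoc (c′ i) (r i) x)))
                     (sym (*-distribʳ-sumFin (suc m) x (λ i → c′ i * r i)))

    split : ∀ j → linearCombination c vs j ≡ - S * vs p j + sumFin (suc m) (λ i → c′ i * vs (punchIn p i) j)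
    split j = sumFin-insertAt (suc m) c′ p (- S) (λ i → vs i j)

    c·vs≡0 : ∀ j → linearCombination c vs j ≡ 0ℚ
    c·vs≡0 zero = begin
      linearCombination c vs zero                           ≡⟨ split zero ⟩
      - S * a + sumFin (suc m) (λ i → c′ i * vs (punchIn p i) zero)
        ≡⟨ cong (- S * a +_) (trans (sumFin-cong (suc m) (λ i → cong (c′ i *_) (column₀ i))) (scaled a)) ⟩
      - S * a + S * a
        ≡⟨ solve 2 (λ S a → (:- S) :* a :+ S :* a := con 0ℚ) refl S a ⟩
      0ℚ ∎
      where
      a : ℚ
      a = vs p zero
    c·vs≡0 (suc j) = begin
      linearCombination c vs (suc j)                        ≡⟨ split (suc j) ⟩
      - S * b + sumFin (suc m) (λ i → c′ i * vs (punchIn p i) (suc j))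
        ≡⟨ cong (- S * b +_) (sumFin-cong (suc m) λ i →
             solve 4 (λ c v r b → c :* v := c :* (v :- r :* b) :+ c :* (r :* b)) refl
                     (c′ i) (vs (punchIn p i) (suc j)) (r i) b) ⟩
      - S * b + sumFin (suc m) (λ i → c′ i * w i j + c′ i * (r i * b))
        ≡⟨ cong (- S * b +_) (sumFin-distrib-+ (suc m) (λ i → c′ i * w i j) (λ i → c′ i * (r i * b))) ⟩
      - S * b + (linearCombination c′ w j + sumFin (suc m) (λ i → c′ i * (r i * b)))
        ≡⟨ cong₂ (λ x y → - S * b + (x + y)) (c′·w≡0 j) (scaled b) ⟩
      - S * b + (0ℚ + S * b)
        ≡⟨ solve 2 (λ S b → (:- S) :* b :+ (con 0ℚ :+ S :* b) := con 0ℚ) refl S b ⟩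
      0ℚ ∎
      where
      b : ℚ
      b = vs p (suc j)

  InEigenspace-linearCombination : ∀ {m n} (M : Matrix n) λ′ (ws : Fin m → Vector n) c →
    (∀ i → InEigenspace n M λ′ (ws i)) → InEigenspace n M λ′ (linearCombination c ws)
  InEigenspace-linearCombination {m} {n} M λ′ ws c eig u = begin
    sumFin n (λ v → M u v * sumFin m (λ i → c i * ws i v))
      ≡⟨ sumFin-cong n (λ v → *-distribˡ-sumFin m (M u v) (λ i → c i * ws i v)) ⟩
    sumFin n (λ v → sumFin m (λ i → M u v * (c i * ws i v)))
      ≡⟨ sumFin-comm n m (λ v i → M u v * (c i * ws i v)) ⟩
    sumFin m (λ i → sumFin n (λ v → M u v * (c i * ws i v)))
      ≡⟨ sumFin-cong m (λ i → sumFin-cong n (λ v → swap (M u v) (c i) (ws i v))) ⟩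
    sumFin m (λ i → sumFin n (λ v → c i * (M u v * ws i v)))
      ≡⟨ sumFin-cong m (λ i → sym (*-distribˡ-sumFin n (c i) (λ v → M u v * ws i v))) ⟩
    sumFin m (λ i → c i * sumFin n (λ v → M u v * ws i v))
      ≡⟨ sumFin-cong m (λ i → cong (c i *_) (eig i u)) ⟩
    sumFin m (λ i → c i * (λ′ * ws i u))
      ≡⟨ sumFin-cong m (λ i → swap (c i) λ′ (ws i u)) ⟩
    sumFin m (λ i → λ′ * (c i * ws i u))
      ≡⟨ *-distribˡ-sumFin m λ′ (λ i → c i * ws i u) ⟨
    λ′ * linearCombination c ws u ∎
    where
    open ≡-Reasoning
    swap : ∀ x y z → x * (y * z) ≡ y * (x * z)
    swap = solve 3 (λ x y z → x :* (y :* z) := y :* (x :* z)) refl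

  DeterminedBy : ∀ {m n} → (Vector n → Set) → (Fin m → Fin n) → Set
  DeterminedBy {n = n} V e = ∀ y → V y → (∀ j → y (e j) ≡ 0ℚ) → ∀ u → y u ≡ 0ℚ

  determinedBy⇒¬LinIndep-suc : ∀ {m n} (M : Matrix n) λ′ (e : Fin m → Fin n) → DeterminedBy (InEigenspace n M λ′) e →
    (ws : Fin (suc m) → Vector n) → (∀ i → InEigenspace n M λ′ (ws i)) → ¬ LinIndep n (suc m) ws
  determinedBy⇒¬LinIndep-suc {m} M λ′ e determined ws eig
    with more-vectors-than-coordinates⇒dependent m (λ i j → ws i (e j))
  ... | c , c≢0 , c·ws∘e≡0 = dependent⇒¬LinIndep {vs = ws} (c , c≢0 ,
    determined (linearCombination c ws) (InEigenspace-linearCombination M λ′ ws c eig) c·ws∘e≡0)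

  shifted-indicators-independent : ∀ {m n} a → a ≢ 0ℚ → (f : Fin m → Fin n) → (∀ i j → f i ≡ f j → i ≡ j) →
    (w : Fin n) → (∀ i → f i ≢ w) → LinIndep n m (λ i v → a * δ (f i) v - 1ℚ)
  shifted-indicators-independent {m} {n} a a≢0 f f-injective w w∉f c c·vs≡0 k =
    *-cancelˡ-zero a (c k) a≢0 (begin
      a * c k                                ≡⟨ cong (a *_) (pick k) ⟨
      a * sumFin m (λ i → c i * δ (f i) (f k)) ≡⟨ combination (f k) ⟩
      S                                      ≡⟨ combination w ⟨
      a * sumFin m (λ i → c i * δ (f i) w)   ≡⟨ cong (a *_) miss ⟩
      a * 0ℚ                                 ≡⟨ *-zeroʳ a ⟩
      0ℚ                                     ∎)
    where
    open ≡-Reasoning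
    S : ℚ
    S = sumFin m c

    combination : ∀ j → a * sumFin m (λ i → c i * δ (f i) j) ≡ S
    combination j = x∙y⁻¹≈ε⇒x≈y _ S (begin
      a * sumFin m (λ i → c i * δ (f i) j) - S
        ≡⟨ cong (_- S) (*-distribˡ-sumFin m a (λ i → c i * δ (f i) j)) ⟩
      sumFin m (λ i → a * (c i * δ (f i) j)) - S
        ≡⟨ sumFin-distrib-- m (λ i → a * (c i * δ (f i) j)) c ⟨
      sumFin m (λ i → a * (c i * δ (f i) j) - c i)
        ≡⟨ sumFin-cong m (λ i → solve 3 (λ a c d → a :* (c :* d) :- c := c :* (a :* d :- con 1ℚ)) refl a (c i) (δ (f i) j)) ⟩
      sumFin m (λ i → c i * (a * δ (f i) j - 1ℚ))
        ≡⟨ c·vs≡0 j ⟩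
      0ℚ ∎)

    pick : ∀ k → sumFin m (λ i → c i * δ (f i) (f k)) ≡ c k
    pick k = begin
      sumFin m (λ i → c i * δ (f i) (f k))
        ≡⟨ sumFin-single m _ k (λ i i≢k → trans (cong (c i *_) (δ-≢ (i≢k ∘ f-injective i k))) (*-zeroʳ (c i))) ⟩
      c k * δ (f k) (f k)                  ≡⟨ cong (c k *_) (δ-refl (f k)) ⟩
      c k * 1ℚ                             ≡⟨ *-identityʳ (c k) ⟩
      c k                                  ∎

    miss : sumFin m (λ i → c i * δ (f i) w) ≡ 0ℚ
    miss = trans (sumFin-cong m (λ i → trans (cong (c i *_) (δ-≢ (w∉f i))) (*-zeroʳ (c i)))) (sumFin-zero m)

module GraphLaplacian where

  open import Defs
  open Sums
  open LinearAlgebra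
  import Data.Nat as ℕ
  open import Data.Fin as Fin using (Fin)
  open import Data.Rational as ℚ using (ℚ; 0ℚ; 1ℚ; _+_; _*_; -_; _-_; _≤_)
  open import Data.Rational.Properties
  open import Data.Rational.Solver using (module +-*-Solver)
  open import Data.Bool using (Bool; true; false)
  open import Data.Sum using (_⊎_; inj₁; inj₂)
  open import Data.Product using (Σ; _×_; _,_)
  open import Data.Unit using (tt)
  open import Relation.Binary.PropositionalEquality
  open import Relation.Nullary using (yes; no)
  open import Function using (_∘_)
  open import Algebra.Properties.Group +-0-group using (x∙y⁻¹≈ε⇒x≈y)
  open +-*-Solver using (solve; _:+_; _:*_; :-_; _:-_; _:=_; con)

  square-nonneg : ∀ p → 0ℚ ≤ p * p
  square-nonneg p with ≤-total 0ℚ p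
  ... | inj₁ p≥0 = let instance _ = ℚ.nonNegative p≥0 in nonNegative⁻¹ (p * p) {{nonNeg*nonNeg⇒nonNeg p p}}
  ... | inj₂ p≤0 = let instance _ = ℚ.nonPositive p≤0 in nonNegative⁻¹ (p * p) {{nonPos*nonPos⇒nonPos p p}}

  square≡0 : ∀ p → p * p ≡ 0ℚ → p ≡ 0ℚ
  square≡0 p p²≡0 with p ≟ 0ℚ
  ... | yes p≡0 = p≡0
  ... | no p≢0 = *-cancelˡ-zero p p p≢0 p²≡0

  *-nonneg : ∀ {p q} → 0ℚ ≤ p → 0ℚ ≤ q → 0ℚ ≤ p * q
  *-nonneg {p} {q} p≥0 q≥0 = subst (_≤ p * q) (*-zeroʳ p) (*-monoˡ-≤-nonNeg p {{ℚ.nonNegative p≥0}} q≥0)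

  two-valued-sum≡0⇒≡0 : ∀ n (y : Vector n) w → (∀ u → y u ≡ 0ℚ ⊎ y u ≡ y w) → sumFin n y ≡ 0ℚ → ∀ u → y u ≡ 0ℚ
  two-valued-sum≡0⇒≡0 n y w two-valued Σy≡0 u with two-valued u
  ... | inj₁ yu≡0 = yu≡0
  ... | inj₂ yu≡yw = trans yu≡yw yw≡0
    where
    χ : Vector n
    χ u with two-valued u
    ... | inj₁ _ = 0ℚ
    ... | inj₂ _ = 1ℚ
    y≡χyw : ∀ u → y u ≡ χ u * y w
    y≡χyw u with two-valued u
    ... | inj₁ yu≡0 = trans yu≡0 (sym (*-zeroˡ (y w)))
    ... | inj₂ yu≡yw = trans yu≡yw (sym (*-identityˡ (y w)))
    χ≥0 : ∀ u → 0ℚ ≤ χ u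
    χ≥0 u with two-valued u
    ... | inj₁ _ = ≤-refl
    ... | inj₂ _ = ≤ᵇ⇒≤ tt
    Σχ*yw≡0 : sumFin n χ * y w ≡ 0ℚ
    Σχ*yw≡0 = trans (*-distribʳ-sumFin n (y w) χ) (trans (sym (sumFin-cong n y≡χyw)) Σy≡0)
    yw≡0 : y w ≡ 0ℚ
    yw≡0 with y w ≟ 0ℚ
    ... | yes yw≡0 = yw≡0
    ... | no yw≢0 = trans (y≡χyw w) (trans (cong (_* y w) χw≡0) (*-zeroˡ (y w)))
      where
      χw≡0 : χ w ≡ 0ℚ
      χw≡0 = sumFin-nonneg-zero n χ χ≥0 (*-cancelˡ-zero (y w) _ yw≢0 (trans (*-comm (y w) _) Σχ*yw≡0)) w

  symmetric-energy≡0 : ∀ n (B : Matrix n) (x : Vector n) → (∀ u v → B u v ≡ B v u) →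
    (∀ u → sumFin n (λ v → B u v * (x u - x v)) ≡ 0ℚ) →
    sumFin n (λ u → sumFin n (λ v → B u v * ((x u - x v) * (x u - x v)))) ≡ 0ℚ
  symmetric-energy≡0 n B x B-sym balanced = begin
    sumFin n (λ u → sumFin n (λ v → B u v * ((x u - x v) * (x u - x v))))
      ≡⟨ sumFin-cong n (λ u → trans (sumFin-cong n (λ v → split u v)) (sumFin-distrib-+ n _ _)) ⟩
    sumFin n (λ u → sumFin n (λ v → x u * (B u v * (x u - x v))) + sumFin n (λ v → x v * (B u v * (x v - x u))))
      ≡⟨ sumFin-distrib-+ n _ _ ⟩
    Σ₁ + sumFin n (λ u → sumFin n (λ v → x v * (B u v * (x v - x u))))
      ≡⟨ cong (Σ₁ +_) (sumFin-comm n n (λ u v → x v * (B u v * (x v - x u)))) ⟩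
    Σ₁ + sumFin n (λ v → sumFin n (λ u → x v * (B u v * (x v - x u))))
      ≡⟨ cong (Σ₁ +_) (sumFin-cong n (λ v → sumFin-cong n (λ u → cong (λ b → x v * (b * (x v - x u))) (B-sym u v)))) ⟩
    Σ₁ + Σ₁
      ≡⟨ cong₂ _+_ vanish vanish ⟩
    0ℚ + 0ℚ
      ≡⟨ +-identityˡ 0ℚ ⟩
    0ℚ ∎
    where
    open ≡-Reasoning
    split : ∀ u v → B u v * ((x u - x v) * (x u - x v)) ≡ x u * (B u v * (x u - x v)) + x v * (B u v * (x v - x u))
    split u v = solve 3 (λ b p q → b :* ((p :- q) :* (p :- q)) := p :* (b :* (p :- q)) :+ q :* (b :* (q :- p)))
                        refl (B u v) (x u) (x v)
    Σ₁ : ℚ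
    Σ₁ = sumFin n (λ u → sumFin n (λ v → x u * (B u v * (x u - x v))))
    vanish : Σ₁ ≡ 0ℚ
    vanish = trans (sumFin-cong n (λ u → trans (sym (*-distribˡ-sumFin n (x u) _))
                                             (trans (cong (x u *_) (balanced u)) (*-zeroʳ (x u)))))
                   (sumFin-zero n)

  module SimpleGraph {n} (adj : Fin n → Fin n → Bool)
                     (adj-sym : ∀ u v → adj u v ≡ adj v u) (adj-irrefl : ∀ u → adj u u ≡ false) where

    open ≡-Reasoning

    private
      A D L : Matrix n
      A = adjMatrix n adj
      D = degMatrix n adj
      L = laplacian n adj
      deg : Fin n → ℚ
      deg = degree n adj
      N : ℚ
      N = natℚ n

    Dominating : Fin n → Set
    Dominating d = ∀ v → v ≢ d → adj d v ≡ true

    adjMatrix-sym : ∀ u v → A u v ≡ A v u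
    adjMatrix-sym u v = cong boolℚ (adj-sym u v)

    degMatrix-diag : ∀ u → D u u ≡ deg u
    degMatrix-diag u = if-yes (u Fin.≟ u) refl

    degMatrix-≢ : ∀ {u v} → u ≢ v → D u v ≡ 0ℚ
    degMatrix-≢ {u} {v} = if-no (u Fin.≟ v)

    laplacian-apply : ∀ (x : Vector n) u → sumFin n (λ v → L u v * x v) ≡ deg u * x u - sumFin n (λ v → A u v * x v)
    laplacian-apply x u = begin
      sumFin n (λ v → L u v * x v)
        ≡⟨ sumFin-cong n (λ v → solve 3 (λ d a y → (d :- a) :* y := d :* y :- a :* y) refl (D u v) (A u v) (x v)) ⟩
      sumFin n (λ v → D u v * x v - A u v * x v)
        ≡⟨ sumFin-distrib-- n _ _ ⟩
      sumFin n (λ v → D u v * x v) - Ax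
        ≡⟨ cong (_- Ax) (sumFin-single n _ u (λ v v≢u → trans (cong (_* x v) (degMatrix-≢ (v≢u ∘ sym))) (*-zeroˡ (x v)))) ⟩
      D u u * x u - Ax
        ≡⟨ cong (λ d → d * x u - Ax) (degMatrix-diag u) ⟩
      deg u * x u - Ax ∎
      where
      Ax : ℚ
      Ax = sumFin n (λ v → A u v * x v)

    laplacian-row-sum : ∀ u → sumFin n (L u) ≡ 0ℚ
    laplacian-row-sum u = begin
      sumFin n (L u)                             ≡⟨ sumFin-distrib-- n (D u) (A u) ⟩
      sumFin n (D u) - deg u
        ≡⟨ cong (_- deg u) (sumFin-single n (D u) u (λ v v≢u → degMatrix-≢ (v≢u ∘ sym))) ⟩
      D u u - deg u                              ≡⟨ cong (_- deg u) (degMatrix-diag u) ⟩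
      deg u - deg u                              ≡⟨ +-inverseʳ (deg u) ⟩
      0ℚ                                         ∎

    laplacian-column-sum : ∀ v → sumFin n (λ u → L u v) ≡ 0ℚ
    laplacian-column-sum v = begin
      sumFin n (λ u → L u v)                     ≡⟨ sumFin-distrib-- n (λ u → D u v) (λ u → A u v) ⟩
      sumFin n (λ u → D u v) - sumFin n (λ u → A u v)
        ≡⟨ cong₂ _-_ (sumFin-single n (λ u → D u v) v (λ _ → degMatrix-≢)) (sumFin-cong n (λ u → adjMatrix-sym u v)) ⟩
      D v v - deg v                              ≡⟨ cong (_- deg v) (degMatrix-diag v) ⟩
      deg v - deg v                              ≡⟨ +-inverseʳ (deg v) ⟩
      0ℚ                                         ∎

    eigenvector-sum≡0 : ∀ {λ′} x → λ′ ≢ 0ℚ → InEigenspace n L λ′ x → sumFin n x ≡ 0ℚ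
    eigenvector-sum≡0 {λ′} x λ′≢0 eig = *-cancelˡ-zero λ′ (sumFin n x) λ′≢0 (begin
      λ′ * sumFin n x                                   ≡⟨ *-distribˡ-sumFin n λ′ x ⟩
      sumFin n (λ u → λ′ * x u)                         ≡⟨ sumFin-cong n eig ⟨
      sumFin n (λ u → sumFin n (λ v → L u v * x v))     ≡⟨ sumFin-comm n n (λ u v → L u v * x v) ⟩
      sumFin n (λ v → sumFin n (λ u → L u v * x v))
        ≡⟨ sumFin-cong n (λ v → *-distribʳ-sumFin n (x v) (λ u → L u v)) ⟨
      sumFin n (λ v → sumFin n (λ u → L u v) * x v)
        ≡⟨ sumFin-cong n (λ v → trans (cong (_* x v) (laplacian-column-sum v)) (*-zeroˡ (x v))) ⟩
      sumFin n (λ _ → 0ℚ)                               ≡⟨ sumFin-zero n ⟩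
      0ℚ                                                ∎)

    degree-dominating : ∀ {d} → Dominating d → deg d ≡ N - 1ℚ
    degree-dominating {d} dom = begin
      sumFin n (A d)                         ≡⟨ sumFin-cong n entry ⟩
      sumFin n (λ v → 1ℚ - δ d v)            ≡⟨ sumFin-distrib-- n (λ _ → 1ℚ) (δ d) ⟩
      sumFin n (λ _ → 1ℚ) - sumFin n (δ d)
        ≡⟨ cong₂ _-_ (sumFin-const n 1ℚ) (sumFin-single n (δ d) d (λ v v≢d → δ-≢ (v≢d ∘ sym))) ⟩
      N * 1ℚ - δ d d                         ≡⟨ cong₂ _-_ (*-identityʳ N) (δ-refl d) ⟩
      N - 1ℚ                                 ∎
      where
      entry : ∀ v → A d v ≡ 1ℚ - δ d v
      entry v with d Fin.≟ v
      ... | yes refl = cong boolℚ (adj-irrefl d)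
      ... | no d≢v = cong boolℚ (dom v (d≢v ∘ sym))

    laplacian-dominating-column : ∀ {d} → Dominating d → ∀ u → L u d ≡ N * δ d u - 1ℚ
    laplacian-dominating-column {d} dom u with d Fin.≟ u
    ... | yes refl = begin
      D d d - A d d
        ≡⟨ cong₂ _-_ (trans (degMatrix-diag d) (degree-dominating dom)) (cong boolℚ (adj-irrefl d)) ⟩
      (N - 1ℚ) - 0ℚ         ≡⟨ solve 1 (λ y → (y :- con 1ℚ) :- con 0ℚ := y :* con 1ℚ :- con 1ℚ) refl N ⟩
      N * 1ℚ - 1ℚ           ∎
    ... | no d≢u = begin
      D u d - A u d
        ≡⟨ cong₂ _-_ (degMatrix-≢ (d≢u ∘ sym)) (trans (adjMatrix-sym u d) (cong boolℚ (dom u (d≢u ∘ sym)))) ⟩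
      0ℚ - 1ℚ               ≡⟨ solve 1 (λ y → con 0ℚ :- con 1ℚ := y :* con 0ℚ :- con 1ℚ) refl N ⟩
      N * 0ℚ - 1ℚ           ∎

    dominating-eigenvector : ∀ {d} → Dominating d → InEigenspace n L N (λ v → N * δ d v - 1ℚ)
    dominating-eigenvector {d} dom u = begin
      sumFin n (λ v → L u v * (N * δ d v - 1ℚ))
        ≡⟨ sumFin-cong n (λ v → solve 3 (λ l y e → l :* (y :* e :- con 1ℚ) := y :* (l :* e) :- l) refl (L u v) N (δ d v)) ⟩
      sumFin n (λ v → N * (L u v * δ d v) - L u v)
        ≡⟨ sumFin-distrib-- n _ (L u) ⟩
      sumFin n (λ v → N * (L u v * δ d v)) - sumFin n (L u)
        ≡⟨ cong₂ _-_ (sym (*-distribˡ-sumFin n N (λ v → L u v * δ d v))) (laplacian-row-sum u) ⟩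
      N * sumFin n (λ v → L u v * δ d v) - 0ℚ
        ≡⟨ cong (λ s → N * s - 0ℚ)
                (sumFin-single n _ d (λ v v≢d → trans (cong (L u v *_) (δ-≢ (v≢d ∘ sym))) (*-zeroʳ (L u v)))) ⟩
      N * (L u d * δ d d) - 0ℚ
        ≡⟨ cong (λ e → N * (L u d * e) - 0ℚ) (δ-refl d) ⟩
      N * (L u d * 1ℚ) - 0ℚ
        ≡⟨ solve 2 (λ y l → y :* (l :* con 1ℚ) :- con 0ℚ := y :* l) refl N (L u d) ⟩
      N * L u d
        ≡⟨ cong (N *_) (laplacian-dominating-column dom u) ⟩
      N * (N * δ d u - 1ℚ) ∎

    module _ .{{_ : ℕ.NonZero n}} where

      complement-balanced : ∀ x → InEigenspace n L N x → ∀ u → sumFin n (λ v → (1ℚ - A u v) * (x u - x v)) ≡ 0ℚ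
      complement-balanced x eig u = begin
        sumFin n (λ v → (1ℚ - A u v) * (x u - x v))
          ≡⟨ sumFin-cong n (λ v → solve 3 (λ a p q → (con 1ℚ :- a) :* (p :- q) := (p :- q) :- (a :* p :- a :* q))
                                           refl (A u v) (x u) (x v)) ⟩
        sumFin n (λ v → (x u - x v) - (A u v * x u - A u v * x v))
          ≡⟨ sumFin-distrib-- n _ _ ⟩
        sumFin n (λ v → x u - x v) - sumFin n (λ v → A u v * x u - A u v * x v)
          ≡⟨ cong₂ _-_ (sumFin-distrib-- n (λ _ → x u) x) (sumFin-distrib-- n (λ v → A u v * x u) (λ v → A u v * x v)) ⟩
        (sumFin n (λ _ → x u) - sumFin n x) - (sumFin n (λ v → A u v * x u) - Ax)
          ≡⟨ cong₂ (λ s t → (s - sumFin n x) - (t - Ax)) (sym (sumFin-const n (x u))) (*-distribʳ-sumFin n (x u) (A u)) ⟨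
        (N * x u - sumFin n x) - (deg u * x u - Ax)
          ≡⟨ cong₂ (λ s t → (N * x u - s) - t) (eigenvector-sum≡0 x (natℚ-nonZero n) eig)
                                                (trans (sym (laplacian-apply x u)) (eig u)) ⟩
        (N * x u - 0ℚ) - N * x u
          ≡⟨ solve 1 (λ y → (y :- con 0ℚ) :- y := con 0ℚ) refl (N * x u) ⟩
        0ℚ ∎
        where
        Ax : ℚ
        Ax = sumFin n (λ v → A u v * x v)

      eigenvector-constant-on-non-edges : ∀ x → InEigenspace n L N x → ∀ u v → adj u v ≡ false → x u ≡ x v
      eigenvector-constant-on-non-edges x eig u v u≁v = x∙y⁻¹≈ε⇒x≈y (x u) (x v) (square≡0 (x u - x v) (begin
        (x u - x v) * (x u - x v)              ≡⟨ *-identityˡ _ ⟨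
        1ℚ * ((x u - x v) * (x u - x v))       ≡⟨ cong (λ b → (1ℚ - boolℚ b) * ((x u - x v) * (x u - x v))) u≁v ⟨
        energy u v                             ≡⟨ sumFin-nonneg-zero n (energy u) (energy≥0 u) (energyᵤ≡0 u) v ⟩
        0ℚ                                     ∎))
        where
        B : Matrix n
        B u v = 1ℚ - A u v
        B≥0 : ∀ u v → 0ℚ ≤ B u v
        B≥0 u v with adj u v
        ... | true = ≤-refl
        ... | false = ≤ᵇ⇒≤ tt
        energy : Fin n → Fin n → ℚ
        energy u v = B u v * ((x u - x v) * (x u - x v))
        energy≥0 : ∀ u v → 0ℚ ≤ energy u v
        energy≥0 u v = *-nonneg (B≥0 u v) (square-nonneg (x u - x v))
        energyᵤ≡0 : ∀ u → sumFin n (energy u) ≡ 0ℚ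
        energyᵤ≡0 = sumFin-nonneg-zero n (λ u → sumFin n (energy u)) (λ u → sumFin-nonneg n (energy u) (energy≥0 u))
          (symmetric-energy≡0 n B x (λ u v → cong (_-_ 1ℚ) (adjMatrix-sym u v)) (complement-balanced x eig))

      independent-dominating-eigenvectors : ∀ {m} (f : Fin m → Fin n) → (∀ i j → f i ≡ f j → i ≡ j) →
        (∀ i → Dominating (f i)) → (w : Fin n) → (∀ i → f i ≢ w) →
        Σ (Fin m → Vector n) λ vs → ((i : Fin m) → InEigenspace n L N (vs i)) × LinIndep n m vs
      independent-dominating-eigenvectors f f-injective f-dominating w w∉f =
        (λ i v → N * δ (f i) v - 1ℚ) ,
        (λ i → dominating-eigenvector (f-dominating i)) ,
        shifted-indicators-independent N (natℚ-nonZero n) f f-injective w w∉f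

module Arithmetic where

  open import Defs
  open import Data.Nat as ℕ using (ℕ; zero; suc; _+_; _*_; _^_; _≤_; _<_; z≤n; s≤s)
  open import Data.Nat.Properties
  open import Data.Nat.Divisibility
  open import Data.Nat.GCD using (gcd; gcd[m,n]∣m; gcd-greatest; module Bézout)
  open import Data.Nat.Coprimality as Coprimality using (Coprime)
  open import Data.Nat.Primality using (Prime; prime⇒irreducible; prime⇒nonZero; prime⇒nonTrivial)
  open import Data.Nat.Primality.Factorisation using (factorise)
  open import Data.Nat.ListAction using (product)
  open import Data.Nat.Induction using (<-wellFounded)
  open import Induction.WellFounded using (Acc; acc)
  open import Data.Nat.Solver using (module +-*-Solver)
  open import Data.List using ([]; _∷_)
  open import Data.List.Relation.Unary.All using (_∷_)
  open import Data.Product using (∃-syntax; ∃₂; _×_; _,_)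
  open import Data.Sum using (_⊎_; inj₁; inj₂)
  open import Relation.Binary.PropositionalEquality
  open import Relation.Nullary using (¬_; Dec; yes; no; contradiction)
  open import Relation.Nullary.Decidable using (_⊎-dec_)
  open +-*-Solver using (solve; _:+_; _:*_; _:=_; con)
  open ≡-Reasoning

  m∣n⇒gcd[m,n]≡m : ∀ {m n} → m ∣ n → gcd m n ≡ m
  m∣n⇒gcd[m,n]≡m {m} {n} m∣n = ∣-antisym (gcd[m,n]∣m m n) (gcd-greatest ∣-refl m∣n)

  -- Bézout may give 1 + x d ≡ y n; then (n - 1) x is the inverse of d modulo n.
  inverse-mod : ∀ {d n} → 2 ≤ n → gcd d n ≡ 1 → ∃₂ λ k q → k * d ≡ 1 + q * n
  inverse-mod {d} {suc (suc a)} (s≤s (s≤s _)) gcd≡1 with Coprimality.coprime-Bézout (Coprimality.gcd≡1⇒coprime gcd≡1)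
  ... | Bézout.+- x y eq = x , y , sym eq
  ... | Bézout.-+ x zero eq = contradiction (trans eq (*-zeroˡ (suc (suc a)))) λ ()
  ... | Bézout.-+ x (suc b) eq = x * suc a , b + a * suc b , +-cancelˡ-≡ (suc a) _ _ (begin
    suc a + x * suc a * d
      ≡⟨ solve 3 (λ a x d → (con 1 :+ a) :+ x :* (con 1 :+ a) :* d := (con 1 :+ x :* d) :* (con 1 :+ a)) refl a x d ⟩
    (1 + x * d) * suc a                  ≡⟨ cong (_* suc a) eq ⟩
    suc b * suc (suc a) * suc a
      ≡⟨ solve 2 (λ a b → (con 1 :+ b) :* (con 2 :+ a) :* (con 1 :+ a)
                       := (con 1 :+ a) :+ (con 1 :+ (b :+ a :* (con 1 :+ b)) :* (con 2 :+ a))) refl a b ⟩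
    suc a + (1 + (b + a * suc b) * suc (suc a)) ∎)

  prime≥2 : ∀ {p} → Prime p → 2 ≤ p
  prime≥2 {p} p-prime = ℕ.nonTrivial⇒n>1 p {{prime⇒nonTrivial p-prime}}

  ∃-prime-divisor : ∀ {n} → 2 ≤ n → ∃[ p ] Prime p × p ∣ n
  ∃-prime-divisor {n@(suc (suc _))} (s≤s (s≤s z≤n)) with factorise n
  ... | record { factors = [] ; isFactorisation = () }
  ... | record { factors = p ∷ ps ; isFactorisation = n≡p*∏ps ; factorsPrime = p-prime ∷ _ } =
    p , p-prime , divides (product ps) (trans n≡p*∏ps (*-comm p (product ps)))

  prime-power-split : ∀ {p} → Prime p → ∀ n → .{{ℕ.NonZero n}} → ∃₂ λ a m → n ≡ p ^ a * m × ¬ p ∣ m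
  prime-power-split {p} p-prime n = split n (<-wellFounded n)
    where
    split : ∀ n → .{{ℕ.NonZero n}} → Acc _<_ n → ∃₂ λ a m → n ≡ p ^ a * m × ¬ p ∣ m
    split n (acc rec) with p ∣? n
    ... | no p∤n = 0 , n , sym (*-identityˡ n) , p∤n
    ... | yes (divides q refl) with split q {{m*n≢0⇒m≢0 q}} (rec (m<m*n q p {{m*n≢0⇒m≢0 q}} (prime≥2 p-prime)))
    ...   | a , m , q≡pᵃm , p∤m =
      suc a , m , trans (cong (_* p) q≡pᵃm) (solve 3 (λ x m p → x :* m :* p := p :* x :* m) refl (p ^ a) m p) , p∤m

  prime-power-coprime : ∀ {p m} → Prime p → ¬ p ∣ m → ∀ a → Coprime (p ^ a) m
  prime-power-coprime {p} {m} p-prime p∤m zero = Coprimality.1-coprimeTo m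
  prime-power-coprime {p} {m} p-prime p∤m (suc a) {d} (d∣p*pᵃ , d∣m) =
    prime-power-coprime p-prime p∤m a (Coprimality.coprime-divisor d⊥p d∣p*pᵃ , d∣m)
    where
    d⊥p : Coprime d p
    d⊥p {e} (e∣d , e∣p) with prime⇒irreducible p-prime e∣p
    ... | inj₁ e≡1 = e≡1
    ... | inj₂ refl = contradiction (∣-trans e∣d d∣m) p∤m

  non-prime-power⇒coprime-split : ∀ {n} → 2 ≤ n → ¬ IsPrimePower n →
    ∃₂ λ a b → 2 ≤ a × 2 ≤ b × n ≡ a * b × Coprime a b
  non-prime-power⇒coprime-split {n} 2≤n not-pp with ∃-prime-divisor 2≤n
  ... | p , p-prime , p∣n with prime-power-split p-prime n {{ℕ.>-nonZero (≤-trans (s≤s z≤n) 2≤n)}}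
  ... | zero , m , n≡m , p∤m = contradiction (subst (p ∣_) (trans n≡m (*-identityˡ m)) p∣n) p∤m
  ... | α@(suc _) , zero , n≡0 , _ = contradiction (subst (2 ≤_) (trans n≡0 (*-zeroʳ (p ^ α))) 2≤n) λ ()
  ... | α@(suc _) , suc zero , n≡pᵅ , _ = contradiction (p , α , p-prime , s≤s z≤n , trans n≡pᵅ (*-identityʳ (p ^ α))) not-pp
  ... | α@(suc α′) , m@(suc (suc _)) , n≡pᵅm , p∤m =
    p ^ α , m , ≤-trans (prime≥2 p-prime) (m≤m*n p (p ^ α′) {{m^n≢0 p α′ {{prime⇒nonZero p-prime}}}}) , s≤s (s≤s z≤n) , n≡pᵅm ,
    prime-power-coprime p-prime p∤m α

  Comparable : ℕ → ℕ → Set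
  Comparable a b = a ∣ b ⊎ b ∣ a

  comparable? : ∀ a b → Dec (Comparable a b)
  comparable? a b = (a ∣? b) ⊎-dec (b ∣? a)

  coprime⇒¬comparable : ∀ {a b} → Coprime a b → 2 ≤ a → 2 ≤ b → ¬ Comparable a b
  coprime⇒¬comparable a⊥b 2≤a _ (inj₁ a∣b) = contradiction (subst (2 ≤_) (a⊥b (∣-refl , a∣b)) 2≤a) λ { (s≤s ()) }
  coprime⇒¬comparable a⊥b _ 2≤b (inj₂ b∣a) = contradiction (subst (2 ≤_) (a⊥b (b∣a , ∣-refl)) 2≤b) λ { (s≤s ()) }

  coprime*-divides : ∀ {a b g} → Coprime a b → a ∣ g → b ∣ g → a * b ∣ g
  coprime*-divides {a} {b} a⊥b (divides t refl) b∣ta =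
    subst (a * b ∣_) (*-comm a t)
      (*-monoʳ-∣ a (Coprimality.coprime-divisor (Coprimality.sym a⊥b) (subst (b ∣_) (*-comm t a) b∣ta)))

  incomparable-with-a-or-b : ∀ {a b g} → Coprime a b → 2 ≤ a → 2 ≤ b → g ≢ 1 → 0 < g → g < a * b →
    ¬ Comparable g a ⊎ ¬ Comparable g b
  incomparable-with-a-or-b {a} {b} {g} a⊥b 2≤a 2≤b g≢1 0<g g<ab with comparable? g a | comparable? g b
  ... | no g≁a | _ = inj₁ g≁a
  ... | yes _ | no g≁b = inj₂ g≁b
  ... | yes (inj₁ g∣a) | yes (inj₁ g∣b) = contradiction (a⊥b (g∣a , g∣b)) g≢1
  ... | yes (inj₂ a∣g) | yes (inj₂ b∣g) = contradiction (∣⇒≤ {{ℕ.>-nonZero 0<g}} (coprime*-divides a⊥b a∣g b∣g)) (<⇒≱ g<ab)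
  ... | yes (inj₁ g∣a) | yes (inj₂ b∣g) = contradiction (inj₂ (∣-trans b∣g g∣a)) (coprime⇒¬comparable a⊥b 2≤a 2≤b)
  ... | yes (inj₂ a∣g) | yes (inj₁ g∣b) = contradiction (inj₁ (∣-trans a∣g g∣b)) (coprime⇒¬comparable a⊥b 2≤a 2≤b)

module Units where

  open Arithmetic using (m∣n⇒gcd[m,n]≡m)
  open import Data.Nat as ℕ using (ℕ; zero; suc; _≤_; _<_; z≤n; s≤s)
  open import Data.Nat.Properties using (suc-injective; ≤∧≢⇒<; <⇒≢; <⇒≤; ≤-trans)
  open import Data.Nat.Divisibility using (∣-refl)
  open import Data.Nat.GCD using (gcd; gcd-identityˡ)
  open import Data.Fin using (Fin; zero; suc; toℕ; fromℕ<)
  open import Data.Fin.Properties using (toℕ-fromℕ<; toℕ-injective)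
  open import Data.List using (List; _∷_; length; lookup; filter; map; upTo)
  open import Data.List.Membership.Propositional using (_∈_)
  open import Data.List.Membership.Propositional.Properties
    using (∈-lookup; ∈-filter⁺; ∈-filter⁻; ∈-map⁺; ∈-map⁻; ∈-upTo⁺; ∈-upTo⁻)
  open import Data.List.Relation.Unary.Any using (here; there; index)
  open import Data.List.Relation.Unary.Any.Properties using (lookup-index)
  import Data.List.Relation.Unary.All as All
  open import Data.List.Relation.Unary.AllPairs using (_∷_)
  open import Data.List.Relation.Unary.Unique.Propositional using (Unique)
  import Data.List.Relation.Unary.Unique.Propositional.Properties as Unique
  open import Data.Product using (∃-syntax; _×_; _,_; proj₁)
  open import Relation.Binary.PropositionalEquality
  open import Relation.Nullary using (contradiction)

  lookup-injective : ∀ {xs : List ℕ} → Unique xs → ∀ i j → lookup xs i ≡ lookup xs j → i ≡ j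
  lookup-injective (_   ∷ _) zero    zero    _  = refl
  lookup-injective (x≢ ∷ _) zero    (suc j) eq = contradiction eq (All.lookup x≢ (∈-lookup j))
  lookup-injective (x≢ ∷ _) (suc i) zero    eq = contradiction (sym eq) (All.lookup x≢ (∈-lookup i))
  lookup-injective (_   ∷ u) (suc i) (suc j) eq = cong suc (lookup-injective u i j eq)

  module Enumeration {n} (xs : List ℕ) (xs-unique : Unique xs) (xs<n : ∀ {k} → k ∈ xs → k < n) where

    enumerate : Fin (length xs) → Fin n
    enumerate i = fromℕ< (xs<n (∈-lookup i))

    toℕ-enumerate : ∀ i → toℕ (enumerate i) ≡ lookup xs i
    toℕ-enumerate i = toℕ-fromℕ< (xs<n (∈-lookup i))

    enumerate-injective : ∀ i j → enumerate i ≡ enumerate j → i ≡ j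
    enumerate-injective i j eq =
      lookup-injective xs-unique i j (trans (sym (toℕ-enumerate i)) (trans (cong toℕ eq) (toℕ-enumerate j)))

    enumerate-∈ : ∀ i → toℕ (enumerate i) ∈ xs
    enumerate-∈ i = subst (_∈ xs) (sym (toℕ-enumerate i)) (∈-lookup i)

    enumerate-surjective : ∀ u → toℕ u ∈ xs → ∃[ i ] enumerate i ≡ u
    enumerate-surjective u u∈xs = index u∈xs , toℕ-injective (trans (toℕ-enumerate (index u∈xs)) (sym (lookup-index u∈xs)))

  -- φ n ≡ length (units n) by definition.
  units : ℕ → List ℕ
  units n = filter (λ k → gcd k n ℕ.≟ 1) (map suc (upTo n))

  units-unique : ∀ n → Unique (units n)
  units-unique n = Unique.filter⁺ _ (Unique.map⁺ suc-injective (Unique.upTo⁺ n))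

  ∈-units⁻ : ∀ {n k} → k ∈ units n → 0 < k × k ≤ n × gcd k n ≡ 1
  ∈-units⁻ {n} k∈units with ∈-filter⁻ (λ k → gcd k n ℕ.≟ 1) {xs = map suc (upTo n)} k∈units
  ... | k∈map , gcd≡1 with ∈-map⁻ suc k∈map
  ... | j , j∈upTo , refl = s≤s z≤n , ∈-upTo⁻ j∈upTo , gcd≡1

  ∈-units⁺ : ∀ {n j} → suc j ≤ n → gcd (suc j) n ≡ 1 → suc j ∈ units n
  ∈-units⁺ {n} j<n gcd≡1 = ∈-filter⁺ (λ k → gcd k n ℕ.≟ 1) (∈-map⁺ suc (∈-upTo⁺ j<n)) gcd≡1

  units<n : ∀ {n k} → 2 ≤ n → k ∈ units n → k < n
  units<n {n} 2≤n k∈units with ∈-units⁻ k∈units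
  ... | _ , k≤n , gcd≡1 = ≤∧≢⇒< k≤n λ { refl →
    contradiction (trans (sym (m∣n⇒gcd[m,n]≡m ∣-refl)) gcd≡1) (λ n≡1 → <⇒≢ 2≤n (sym n≡1)) }

  <-units⇒∈ : ∀ {n k} → 2 ≤ n → k < n → gcd k n ≡ 1 → k ∈ units n
  <-units⇒∈ {n} {zero}  2≤n _   gcd≡1 = contradiction (trans (sym (gcd-identityˡ n)) gcd≡1) (λ n≡1 → <⇒≢ 2≤n (sym n≡1))
  <-units⇒∈ {n} {suc k} _   k<n gcd≡1 = ∈-units⁺ (<⇒≤ k<n) gcd≡1

  0∷units-unique : ∀ n → Unique (0 ∷ units n)
  0∷units-unique n = All.tabulate (λ k∈units → <⇒≢ (proj₁ (∈-units⁻ {n} k∈units))) ∷ units-unique n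

  0∷units<n : ∀ {n k} → 2 ≤ n → k ∈ 0 ∷ units n → k < n
  0∷units<n 2≤n (here refl)       = ≤-trans (s≤s z≤n) 2≤n
  0∷units<n 2≤n (there k∈units) = units<n 2≤n k∈units

module CyclicPowerGraph where

  open import Defs
  open Sums
  open LinearAlgebra
  open GraphLaplacian
  open Arithmetic
  open Units
  open import Data.Rational using (ℚ; 0ℚ)
  open import Data.Nat.Primality using (Prime; prime⇒nonZero)
  open import Data.Nat.Coprimality as Coprimality using (Coprime)
  open import Data.Nat as ℕ using (ℕ; zero; suc; _+_; _*_; _^_; _≤_; _<_; z≤n; s≤s)
  open import Data.Nat.Properties
  open import Data.Nat.Divisibility
  open import Data.Nat.GCD using (gcd; gcd[m,n]∣m; gcd[m,n]∣n; gcd-greatest; gcd[m,n]≢0)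
  open import Data.Fin using (Fin; zero; suc; toℕ; fromℕ<)
  open import Data.Fin.Properties using (toℕ-fromℕ<; toℕ-injective; toℕ<n)
  open import Data.List using (_∷_)
  open import Data.List.Membership.Propositional using (_∈_)
  open import Data.List.Relation.Unary.Any using (here; there)
  open import Data.Product using (Σ; _×_; _,_; proj₁; proj₂)
  open import Data.Sum as Sum using (_⊎_; inj₁; inj₂)
  open import Data.Bool using (Bool; true; false)
  open import Data.Bool.Properties using (¬-not)
  open import Relation.Binary.PropositionalEquality
  open import Relation.Nullary using (¬_; Dec; yes; no; contradiction)
  open import Relation.Nullary.Decidable using (_⊎-dec_)
  open import Function using (_∘_)
  open import Data.Nat.Solver using (module +-*-Solver)
  open +-*-Solver using (solve; _:+_; _:*_; _:=_; con)

  isPowerOf-multiple : ∀ {n} .{{_ : ℕ.NonZero n}} {u v : Fin n} t → toℕ u ≡ t * toℕ v → IsPowerOf n u v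
  isPowerOf-multiple {n} {u} {v} t u≡tv = t + n , toℕ v , ≤-trans (ℕ.>-nonZero⁻¹ n) (m≤n+m n t) , (begin
    (t + n) * toℕ v         ≡⟨ *-distribʳ-+ (toℕ v) t n ⟩
    t * toℕ v + n * toℕ v   ≡⟨ cong₂ _+_ (sym u≡tv) (*-comm n (toℕ v)) ⟩
    toℕ u + toℕ v * n       ∎)
    where open ≡-Reasoning

  isPowerOf-generator : ∀ {n} → 2 ≤ n → {d : Fin n} → gcd (toℕ d) n ≡ 1 → ∀ v → IsPowerOf n v d
  isPowerOf-generator {n} 2≤n {d} gcd≡1 v with inverse-mod 2≤n gcd≡1
  ... | k , q , kd≡1+qn = k * toℕ v + n , q * toℕ v + toℕ d , ≤-trans (≤-trans (s≤s z≤n) 2≤n) (m≤n+m n (k * toℕ v)) , (begin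
    (k * toℕ v + n) * toℕ d
      ≡⟨ solve 4 (λ k v n d → (k :* v :+ n) :* d := v :* (k :* d) :+ n :* d) refl k (toℕ v) n (toℕ d) ⟩
    toℕ v * (k * toℕ d) + n * toℕ d         ≡⟨ cong (λ x → toℕ v * x + n * toℕ d) kd≡1+qn ⟩
    toℕ v * (1 + q * n) + n * toℕ d
      ≡⟨ solve 4 (λ q v n d → v :* (con 1 :+ q :* n) :+ n :* d := v :+ (q :* v :+ d) :* n) refl q (toℕ v) n (toℕ d) ⟩
    toℕ v + (q * toℕ v + toℕ d) * n         ∎)
    where open ≡-Reasoning

  isPowerOf⇒gcd∣gcd : ∀ {n} {u v : Fin n} → IsPowerOf n u v → gcd (toℕ v) n ∣ gcd (toℕ u) n
  isPowerOf⇒gcd∣gcd {n} {u} {v} (k , q , _ , kv≡u+qn) = gcd-greatest g∣u (gcd[m,n]∣n (toℕ v) n)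
    where
    g : ℕ
    g = gcd (toℕ v) n
    g∣u : g ∣ toℕ u
    g∣u = ∣m+n∣m⇒∣n (subst (g ∣_) (trans kv≡u+qn (+-comm (toℕ u) (q * n))) (∣n⇒∣m*n k (gcd[m,n]∣m (toℕ v) n)))
                    (∣n⇒∣m*n q (gcd[m,n]∣n (toℕ v) n))

  true-iff⇒≡ : ∀ {a b : Bool} → (a ≡ true → b ≡ true) → (b ≡ true → a ≡ true) → a ≡ b
  true-iff⇒≡ {false} {false} _   _   = refl
  true-iff⇒≡ {false} {true}  _   b⇒a = b⇒a refl
  true-iff⇒≡ {true}  {false} a⇒b _   = sym (a⇒b refl)
  true-iff⇒≡ {true}  {true}  _   _   = refl

  module PowerGraph {n} (2≤n : 2 ≤ n) (adj : Fin n → Fin n → Bool) (H : IsPowerGraphAdj n adj) where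

    instance
      n-nonZero : ℕ.NonZero n
      n-nonZero = ℕ.>-nonZero (≤-trans (s≤s z≤n) 2≤n)

    gcdₙ : Fin n → ℕ
    gcdₙ u = gcd (toℕ u) n

    ZeroOrGenerator : Fin n → Set
    ZeroOrGenerator u = toℕ u ≡ 0 ⊎ gcdₙ u ≡ 1

    zeroOrGenerator? : ∀ u → Dec (ZeroOrGenerator u)
    zeroOrGenerator? u = (toℕ u ℕ.≟ 0) ⊎-dec (gcdₙ u ℕ.≟ 1)

    adjacent : ∀ {u v} → u ≢ v → IsPowerOf n u v ⊎ IsPowerOf n v u → adj u v ≡ true
    adjacent u≢v related = proj₂ (H _ _) (u≢v , related)

    adj-irrefl : ∀ u → adj u u ≡ false
    adj-irrefl u = ¬-not λ adj≡true → proj₁ (proj₁ (H u u) adj≡true) refl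

    adj-sym : ∀ u v → adj u v ≡ adj v u
    adj-sym u v = true-iff⇒≡ flip-edge flip-edge
      where
      flip-edge : ∀ {u v} → adj u v ≡ true → adj v u ≡ true
      flip-edge adj≡true with proj₁ (H _ _) adj≡true
      ... | u≢v , related = adjacent (u≢v ∘ sym) (Sum.swap related)

    incomparable⇒non-adjacent : ∀ {u v} → ¬ Comparable (gcdₙ u) (gcdₙ v) → adj u v ≡ false
    incomparable⇒non-adjacent incomparable = ¬-not λ adj≡true → incomparable (comparable (proj₂ (proj₁ (H _ _) adj≡true)))
      where
      comparable : ∀ {u v} → IsPowerOf n u v ⊎ IsPowerOf n v u → Comparable (gcdₙ u) (gcdₙ v)
      comparable (inj₁ u-power-of-v) = inj₂ (isPowerOf⇒gcd∣gcd u-power-of-v)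
      comparable (inj₂ v-power-of-u) = inj₁ (isPowerOf⇒gcd∣gcd v-power-of-u)

    open SimpleGraph adj adj-sym adj-irrefl

    zeroOrGenerator-dominating : ∀ {d} → ZeroOrGenerator d → Dominating d
    zeroOrGenerator-dominating (inj₁ d≡0)   v v≢d = adjacent (v≢d ∘ sym) (inj₁ (isPowerOf-multiple 0 d≡0))
    zeroOrGenerator-dominating (inj₂ gcd≡1) v v≢d = adjacent (v≢d ∘ sym) (inj₂ (isPowerOf-generator 2≤n gcd≡1 v))

    ¬zeroOrGenerator : ∀ {k d} (k<n : k < n) → k ≢ 0 → 2 ≤ d → d ∣ k → d ∣ n → ¬ ZeroOrGenerator (fromℕ< k<n)
    ¬zeroOrGenerator k<n k≢0 _   _   _   (inj₁ k≡0)   = k≢0 (trans (sym (toℕ-fromℕ< k<n)) k≡0)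
    ¬zeroOrGenerator k<n _   2≤d d∣k d∣n (inj₂ gcd≡1) =
      <⇒≢ 2≤d (sym (∣1⇒≡1 (subst (_ ∣_) gcd≡1 (gcd-greatest (subst (_ ∣_) (sym (toℕ-fromℕ< k<n)) d∣k) d∣n))))

    gcdₙ-divisor : ∀ {a} (a<n : a < n) → a ∣ n → gcdₙ (fromℕ< a<n) ≡ a
    gcdₙ-divisor a<n a∣n = trans (cong (λ k → gcd k n) (toℕ-fromℕ< a<n)) (m∣n⇒gcd[m,n]≡m a∣n)

    module ZeroOrGenerators = Enumeration (0 ∷ units n) (0∷units-unique n) (0∷units<n 2≤n)

    module Generators = Enumeration (units n) (units-unique n) (units<n 2≤n)

    ∈⇒zeroOrGenerator : ∀ {u} → toℕ u ∈ 0 ∷ units n → ZeroOrGenerator u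
    ∈⇒zeroOrGenerator (here u≡0)       = inj₁ u≡0
    ∈⇒zeroOrGenerator (there u∈units) = inj₂ (proj₂ (proj₂ (∈-units⁻ u∈units)))

    zeroOrGenerator⇒∈ : ∀ {u} → ZeroOrGenerator u → toℕ u ∈ 0 ∷ units n
    zeroOrGenerator⇒∈ (inj₁ u≡0)       = here u≡0
    zeroOrGenerator⇒∈ {u} (inj₂ gcd≡1) = there (<-units⇒∈ 2≤n (toℕ<n u) gcd≡1)

    private
      L : Matrix n
      L = laplacian n adj
      N : ℚ
      N = natℚ n

    multiplicity-if-constant-off-generators : (w : Fin n) → ¬ ZeroOrGenerator w →
      (∀ y → InEigenspace n L N y → ∀ u → ¬ ZeroOrGenerator u → y u ≡ y w) →
      EigenvalueMultiplicity n L N (suc (φ n))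
    multiplicity-if-constant-off-generators w w∉ constant =
      independent-dominating-eigenvectors enumerate enumerate-injective
        (λ i → zeroOrGenerator-dominating (∈⇒zeroOrGenerator (enumerate-∈ i))) w
        (λ i enumerate≡w → w∉ (subst ZeroOrGenerator enumerate≡w (∈⇒zeroOrGenerator (enumerate-∈ i)))) ,
      determinedBy⇒¬LinIndep-suc L N enumerate determined
      where
      open ZeroOrGenerators
      determined : DeterminedBy (InEigenspace n L N) enumerate
      determined y eig y∘enumerate≡0 = two-valued-sum≡0⇒≡0 n y w two-valued (eigenvector-sum≡0 y (natℚ-nonZero n) eig)
        where
        two-valued : ∀ u → y u ≡ 0ℚ ⊎ y u ≡ y w
        two-valued u with zeroOrGenerator? u
        ... | yes special with enumerate-surjective u (zeroOrGenerator⇒∈ special)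
        ...   | i , refl = inj₁ (y∘enumerate≡0 i)
        two-valued u | no ordinary = inj₂ (constant y eig u ordinary)

    prime⇒¬multiplicity : Prime n → ¬ EigenvalueMultiplicity n L N (suc (φ n))
    prime⇒¬multiplicity n-prime ((vs , eig , indep) , _) = determinedBy⇒¬LinIndep-suc L N enumerate determined vs eig indep
      where
      open Generators
      determined : DeterminedBy (InEigenspace n L N) enumerate
      determined y eig y∘enumerate≡0 = two-valued-sum≡0⇒≡0 n y zero′ two-valued (eigenvector-sum≡0 y (natℚ-nonZero n) eig)
        where
        zero′ : Fin n
        zero′ = fromℕ< (ℕ.>-nonZero⁻¹ n)
        two-valued : ∀ u → y u ≡ 0ℚ ⊎ y u ≡ y zero′
        two-valued u with toℕ u ℕ.≟ 0
        ... | yes u≡0 = inj₂ (cong y (toℕ-injective (trans u≡0 (sym (toℕ-fromℕ< _)))))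
        ... | no u≢0 with enumerate-surjective u (<-units⇒∈ 2≤n (toℕ<n u) gcd≡1)
          where
          gcd≡1 : gcdₙ u ≡ 1
          gcd≡1 = Coprimality.coprime⇒gcd≡1
                    (Coprimality.sym (Coprimality.prime⇒coprime n-prime {{ℕ.≢-nonZero u≢0}} (toℕ<n u)))
        ...   | i , refl = inj₁ (y∘enumerate≡0 i)

    extra-dominating⇒¬multiplicity : ∀ {d w} → Dominating d → ¬ ZeroOrGenerator d → ¬ ZeroOrGenerator w → d ≢ w →
      ¬ EigenvalueMultiplicity n L N (suc (φ n))
    extra-dominating⇒¬multiplicity {d} {w} d-dominating d∉ w∉ d≢w (_ , at-most) =
      at-most (proj₁ eigenvectors) (proj₁ (proj₂ eigenvectors)) (proj₂ (proj₂ eigenvectors))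
      where
      open ZeroOrGenerators
      enumerate-special : ∀ i → ZeroOrGenerator (enumerate i)
      enumerate-special i = ∈⇒zeroOrGenerator (enumerate-∈ i)
      f : Fin (suc (suc (φ n))) → Fin n
      f zero    = d
      f (suc i) = enumerate i
      f-injective : ∀ i j → f i ≡ f j → i ≡ j
      f-injective zero    zero    _  = refl
      f-injective zero    (suc j) eq = contradiction (subst ZeroOrGenerator (sym eq) (enumerate-special j)) d∉
      f-injective (suc i) zero    eq = contradiction (subst ZeroOrGenerator eq (enumerate-special i)) d∉
      f-injective (suc i) (suc j) eq = cong suc (enumerate-injective i j eq)
      f-dominating : ∀ i → Dominating (f i)
      f-dominating zero    = d-dominating
      f-dominating (suc i) = zeroOrGenerator-dominating (enumerate-special i)
      w∉f : ∀ i → f i ≢ w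
      w∉f zero    = d≢w
      w∉f (suc i) = λ eq → w∉ (subst ZeroOrGenerator eq (enumerate-special i))
      eigenvectors : Σ (Fin (suc (suc (φ n))) → Vector n) λ vs →
                       ((i : Fin (suc (suc (φ n)))) → InEigenspace n L N (vs i)) × LinIndep n (suc (suc (φ n))) vs
      eigenvectors = independent-dominating-eigenvectors f f-injective f-dominating w w∉f

    prime-power-divisor-dominating : ∀ {p α} → Prime p → n ≡ p ^ α → (p<n : p < n) → Dominating (fromℕ< p<n)
    prime-power-divisor-dominating {p} {α} p-prime n≡pᵅ p<n v v≢p with p ∣? toℕ v
    ... | yes (divides t v≡tp) =
      adjacent (v≢p ∘ sym) (inj₂ (isPowerOf-multiple t (trans v≡tp (cong (t *_) (sym (toℕ-fromℕ< p<n))))))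
    ... | no p∤v = adjacent (v≢p ∘ sym) (inj₁ (isPowerOf-generator 2≤n gcd≡1 (fromℕ< p<n)))
      where
      gcd≡1 : gcdₙ v ≡ 1
      gcd≡1 = Coprimality.coprime⇒gcd≡1
                (Coprimality.sym (subst (λ m → Coprime m (toℕ v)) (sym n≡pᵅ) (prime-power-coprime p-prime p∤v α)))

    -- The extra dominating vertex is p; the vertex p · 2 lies below n = p · p ^ (1 + β) because n ≢ 4.
    prime-power⇒¬multiplicity : ∀ {p β} → Prime p → n ≡ p ^ (2 + β) → n ≢ 4 → ¬ EigenvalueMultiplicity n L N (suc (φ n))
    prime-power⇒¬multiplicity {p} {β} p-prime n≡p*X n≢4 =
      extra-dominating⇒¬multiplicity (prime-power-divisor-dominating {α = 2 + β} p-prime n≡p*X p<n)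
        (¬zeroOrGenerator p<n (ℕ.≢-nonZero⁻¹ p) 2≤p ∣-refl p∣n)
        (¬zeroOrGenerator 2p<n (ℕ.≢-nonZero⁻¹ (p * 2) {{m*n≢0 p 2}}) 2≤p (m∣m*n 2) p∣n)
        (λ eq → <⇒≢ (m<m*n p 2 (s≤s (s≤s z≤n))) (trans (sym (toℕ-fromℕ< p<n)) (trans (cong toℕ eq) (toℕ-fromℕ< 2p<n))))
      where
      open ≡-Reasoning
      instance
        p-nonZero : ℕ.NonZero p
        p-nonZero = prime⇒nonZero p-prime
      X : ℕ
      X = p ^ (1 + β)
      2≤p : 2 ≤ p
      2≤p = prime≥2 p-prime
      p≤X : p ≤ X
      p≤X = m≤m*n p (p ^ β) {{m^n≢0 p β}}
      2<X : 2 < X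
      2<X = ≤∧≢⇒< (≤-trans 2≤p p≤X) λ 2≡X → n≢4 (begin
        n      ≡⟨ n≡p*X ⟩
        p * X  ≡⟨ cong₂ _*_ (≤-antisym (subst (p ≤_) (sym 2≡X) p≤X) 2≤p) (sym 2≡X) ⟩
        4      ∎)
      p<n : p < n
      p<n = subst (p <_) (sym n≡p*X) (m<m*n p X (<-trans (s≤s (s≤s z≤n)) 2<X))
      2p<n : p * 2 < n
      2p<n = subst (p * 2 <_) (sym n≡p*X) (*-monoʳ-< p 2<X)
      p∣n : p ∣ n
      p∣n = subst (p ∣_) (sym n≡p*X) (m∣m*n X)

    non-generator-incomparable : ∀ {a b} → n ≡ a * b → Coprime a b → 2 ≤ a → 2 ≤ b →
      ∀ {u} → ¬ ZeroOrGenerator u → ¬ Comparable (gcdₙ u) a ⊎ ¬ Comparable (gcdₙ u) b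
    non-generator-incomparable {a} {b} n≡ab a⊥b 2≤a 2≤b {u} u∉ = incomparable-with-a-or-b a⊥b 2≤a 2≤b (u∉ ∘ inj₂) 0<g g<ab
      where
      0<g : 0 < gcdₙ u
      0<g = n≢0⇒n>0 (gcd[m,n]≢0 (toℕ u) n (inj₂ (ℕ.≢-nonZero⁻¹ n)))
      g<ab : gcdₙ u < a * b
      g<ab = subst (gcdₙ u <_) n≡ab (≤-<-trans (∣⇒≤ {{ℕ.≢-nonZero (u∉ ∘ inj₁)}} (gcd[m,n]∣m (toℕ u) n)) (toℕ<n u))

    non-prime-power⇒multiplicity : ¬ IsPrimePower n → EigenvalueMultiplicity n L N (suc (φ n))
    non-prime-power⇒multiplicity not-pp with non-prime-power⇒coprime-split 2≤n not-pp
    ... | a , b , 2≤a , 2≤b , n≡ab , a⊥b = multiplicity-if-constant-off-generators vA vA∉ constant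
      where
      instance
        a-nonZero : ℕ.NonZero a
        a-nonZero = ℕ.>-nonZero (≤-trans (s≤s z≤n) 2≤a)
        b-nonZero : ℕ.NonZero b
        b-nonZero = ℕ.>-nonZero (≤-trans (s≤s z≤n) 2≤b)
      n≡ba : n ≡ b * a
      n≡ba = trans n≡ab (*-comm a b)
      a<n : a < n
      a<n = subst (a <_) (sym n≡ab) (m<m*n a b 2≤b)
      b<n : b < n
      b<n = subst (b <_) (sym n≡ba) (m<m*n b a 2≤a)
      vA vB : Fin n
      vA = fromℕ< a<n
      vB = fromℕ< b<n
      gcd-vA : gcdₙ vA ≡ a
      gcd-vA = gcdₙ-divisor a<n (divides b n≡ba)
      gcd-vB : gcdₙ vB ≡ b
      gcd-vB = gcdₙ-divisor b<n (divides a n≡ab)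
      vA∉ : ¬ ZeroOrGenerator vA
      vA∉ = ¬zeroOrGenerator a<n (ℕ.≢-nonZero⁻¹ a) 2≤a ∣-refl (divides b n≡ba)
      vB≁vA : adj vB vA ≡ false
      vB≁vA = incomparable⇒non-adjacent (subst₂ (λ x y → ¬ Comparable x y) (sym gcd-vB) (sym gcd-vA)
                (coprime⇒¬comparable (Coprimality.sym a⊥b) 2≤b 2≤a))
      constant : ∀ y → InEigenspace n L N y → ∀ u → ¬ ZeroOrGenerator u → y u ≡ y vA
      constant y eig u u∉ with non-generator-incomparable n≡ab a⊥b 2≤a 2≤b u∉
      ... | inj₁ g≁a = eigenvector-constant-on-non-edges y eig u vA
                         (incomparable⇒non-adjacent (subst (λ x → ¬ Comparable (gcdₙ u) x) (sym gcd-vA) g≁a))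
      ... | inj₂ g≁b = trans (eigenvector-constant-on-non-edges y eig u vB
                               (incomparable⇒non-adjacent (subst (λ x → ¬ Comparable (gcdₙ u) x) (sym gcd-vB) g≁b)))
                             (eigenvector-constant-on-non-edges y eig vB vA vB≁vA)

open import Defs
open import Data.Nat using (ℕ; _<_; _+_)
open import Data.Fin using (Fin)
open import Data.Bool using (Bool)
open import Data.Sum using (_⊎_)
open import Relation.Binary.PropositionalEquality using (_≡_)
open import Relation.Nullary using (¬_)
open import Function.Bundles using (_⇔_)
open import Data.Rational using (ℚ)

open import Data.Nat as ℕ using (zero; suc; z≤n; s≤s)
open import Data.Nat.Properties using (*-identityʳ; +-comm)
open import Data.Nat.Primality using (Prime)
open import Data.Fin using (zero; suc)
open import Data.Sum using (inj₁; inj₂)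
open import Data.Product using (_,_)
open import Relation.Binary.PropositionalEquality using (refl; sym; trans; subst)
open import Relation.Nullary using (yes; no; contradiction)
open import Function using (_∘_)
open import Function.Bundles using (mk⇔)
open CyclicPowerGraph

four⇒multiplicity : (adj : Fin 4 → Fin 4 → Bool) → IsPowerGraphAdj 4 adj →
  EigenvalueMultiplicity 4 (laplacian 4 adj) (natℚ 4) (suc (φ 4))
four⇒multiplicity adj H = multiplicity-if-constant-off-generators two two∉ constant
  where
  open PowerGraph (s≤s (s≤s z≤n)) adj H
  two : Fin 4
  two = suc (suc zero)
  two∉ : ¬ ZeroOrGenerator two
  two∉ (inj₁ ())
  two∉ (inj₂ ())
  constant : ∀ y → InEigenspace 4 (laplacian 4 adj) (natℚ 4) y → ∀ u → ¬ ZeroOrGenerator u → y u ≡ y two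
  constant y _ zero                   u∉ = contradiction (inj₁ refl) u∉
  constant y _ (suc zero)             u∉ = contradiction (inj₂ refl) u∉
  constant y _ (suc (suc zero))       u∉ = refl
  constant y _ (suc (suc (suc zero))) u∉ = contradiction (inj₂ refl) u∉

theorem3p4 : (n : ℕ) → 1 < n → (adj : Fin n → Fin n → Bool) → IsPowerGraphAdj n adj →
    EigenvalueMultiplicity n (laplacian n adj) (natℚ n) (φ n + 1) ⇔ (n ≡ 4 ⊎ ¬ IsPrimePower n)
theorem3p4 n 1<n adj H = mk⇔ (only-if ∘ subst Multiplicity (sym 1+φ≡φ+1)) (subst Multiplicity 1+φ≡φ+1 ∘ if)
  where
  open PowerGraph 1<n adj H
  Multiplicity : ℕ → Set
  Multiplicity = EigenvalueMultiplicity n (laplacian n adj) (natℚ n)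
  1+φ≡φ+1 : suc (φ n) ≡ φ n + 1
  1+φ≡φ+1 = +-comm 1 (φ n)

  only-if : Multiplicity (suc (φ n)) → n ≡ 4 ⊎ ¬ IsPrimePower n
  only-if multiplicity with n ℕ.≟ 4
  ... | yes n≡4 = inj₁ n≡4
  ... | no n≢4 = inj₂ λ where
    (p , suc zero    , p-prime , _ , n≡p) →
      prime⇒¬multiplicity (subst Prime (sym (trans n≡p (*-identityʳ p))) p-prime) multiplicity
    (p , suc (suc β) , p-prime , _ , n≡pᵝ⁺²) →
      prime-power⇒¬multiplicity {β = β} p-prime n≡pᵝ⁺² n≢4 multiplicity

  if : n ≡ 4 ⊎ ¬ IsPrimePower n → Multiplicity (suc (φ n))
  if (inj₁ n≡4)    = subst (λ m → (adj : Fin m → Fin m → Bool) → IsPowerGraphAdj m adj →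
                              EigenvalueMultiplicity m (laplacian m adj) (natℚ m) (suc (φ m)))
                           (sym n≡4) four⇒multiplicity adj H
  if (inj₂ not-pp) = non-prime-power⇒multiplicity not-pp
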